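{- Let $G$ and $H$ be graphs on $m\ge 2$ and $n\ge 2$ vertices respectively. Then $b_2(G\vee H)\le 4$ and $t_2(G\vee H)\le 3$.
   Context: The join $G\vee H$ has vertex set $V(G)\cup V(H)$ (disjoint) and edge set $E(G)\cup E(H)\cup\{xy: x\in V(G), y\in V(H)\}$. The 2-burning process: given a graph $G$ and a sequence $s=(s_1,\dots,s_k)$ of vertices of $G$ (sources), at round $0$ all vertices are uncolored; at each round $j\ge1$, (i) if $j\le k$ and $s_j$ is uncolored, $s_j$ is colored blue, and (ii) every uncolored vertex having at least two neighbors that were blue at the end of round $j-1$ is colored blue. $s$ is a 2-burning sequence if eventually all vertices are blue; $\mathrm{len}(s)=k$ and $\mathrm{rd}(s)$ is the first round at the end of which all vertices are blue. $b_2(G)$ is the minimum of $\mathrm{rd}(s)$ over all 2-burning sequences; a 2-burning sequence achieving it is optimal; $t_2(G)$ is the minimum length of an optimal 2-burning sequence. -}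

module Defs where

open import Data.Nat using (ℕ; zero; suc; _+_; _≤_; _<_; _≤ᵇ_)
open import Data.Bool using (Bool; true; false; _∧_; _∨_; T)
open import Data.Fin using (Fin; splitAt; _≟_)
open import Data.Sum using (inj₁; inj₂)
open import Data.List using (List; []; _∷_; length; filterᵇ; allFin)
open import Data.Product using (Σ; _×_; ∃; ∃-syntax)
open import Relation.Nullary using (¬_)
open import Relation.Nullary.Decidable using (⌊_⌋)
open import Relation.Binary.PropositionalEquality using (_≡_)

record Graph (n : ℕ) : Set where
  field
    adj    : Fin n → Fin n → Bool
    sym    : ∀ x y → adj x y ≡ adj y x
    irrefl : ∀ x → adj x x ≡ false
open Graph public

joinAdj : ∀ {m n} → Graph m → Graph n → Fin (m + n) → Fin (m + n) → Bool
joinAdj {m} G H x y with splitAt m x | splitAt m y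
... | inj₁ a | inj₁ b = adj G a b
... | inj₂ a | inj₂ b = adj H a b
... | inj₁ _ | inj₂ _ = true
... | inj₂ _ | inj₁ _ = true

joinSym : ∀ {m n} (G : Graph m) (H : Graph n) x y → joinAdj G H x y ≡ joinAdj G H y x
joinSym {m} G H x y with splitAt m x | splitAt m y
... | inj₁ a | inj₁ b = sym G a b
... | inj₂ a | inj₂ b = sym H a b
... | inj₁ _ | inj₂ _ = Relation.Binary.PropositionalEquality.refl
... | inj₂ _ | inj₁ _ = Relation.Binary.PropositionalEquality.refl

joinIrrefl : ∀ {m n} (G : Graph m) (H : Graph n) x → joinAdj G H x x ≡ false
joinIrrefl {m} G H x with splitAt m x
... | inj₁ a = irrefl G a
... | inj₂ a = irrefl H a

_∨ᴳ_ : ∀ {m n} → Graph m → Graph n → Graph (m + n)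
G ∨ᴳ H = record { adj = joinAdj G H ; sym = joinSym G H ; irrefl = joinIrrefl G H }

-- Source s_{j+1} of the sequence (0-based index j) equals v?
isSource : ∀ {N} → List (Fin N) → ℕ → Fin N → Bool
isSource []       _       _ = false
isSource (x ∷ xs) zero    v = ⌊ x ≟ v ⌋
isSource (x ∷ xs) (suc j) v = isSource xs j v

blueNbrs : ∀ {N} → Graph N → (Fin N → Bool) → Fin N → ℕ
blueNbrs {N} G B v = length (filterᵇ (λ u → adj G v u ∧ B u) (allFin N))

-- blue G s j v : v is blue at the end of round j of the 2-burning process
blue : ∀ {N} → Graph N → List (Fin N) → ℕ → Fin N → Bool
blue G s zero    v = false
blue G s (suc j) v = blue G s j v ∨ isSource s j v ∨ (2 ≤ᵇ blueNbrs G (blue G s j) v)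

AllBlueAt : ∀ {N} → Graph N → List (Fin N) → ℕ → Set
AllBlueAt G s r = ∀ v → T (blue G s r v)

Rd : ∀ {N} → Graph N → List (Fin N) → ℕ → Set
Rd G s r = AllBlueAt G s r × (∀ r' → r' < r → ¬ AllBlueAt G s r')

Optimal : ∀ {N} → Graph N → List (Fin N) → Set
Optimal G s = ∃[ r ] (Rd G s r × (∀ s' r' → Rd G s' r' → r ≤ r'))

B2≤ : ∀ {N} → Graph N → ℕ → Set
B2≤ G k = ∃[ s ] ∃[ r ] (Rd G s r × r ≤ k)

T2≤ : ∀ {N} → Graph N → ℕ → Set
T2≤ G k = ∃[ s ] (Optimal G s × length s ≤ k)

{-# OPTIONS --safe #-}
-- After round 1 only the first source is blue, so no vertex has two blue
-- neighbours yet, and after round 2 only the first two sources are blue; hence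
-- b₂ ≥ 3 on any graph with three vertices.  In G ∨ H two sources in G make all
-- of H blue in round 3, and two blue vertices of H then make all of G blue in
-- round 4, so b₂ ≤ 4.  Either some sequence finishes in round 3 (it may be
-- truncated to length 3, since round 3 only sees the first three sources), or
-- b₂ = 4 and the two-source sequence is optimal.  Because of the truncation the
-- case split is decidable, by exhaustive search over sequences of length ≤ 3.
module Submission where

open import Defs hiding (sym)
open import Data.Bool using (Bool; T; _∧_; _∨_)
open import Data.Bool.Properties using (T-∨; T-∧)
open import Data.Empty using (⊥)
open import Data.Fin using (Fin; _↑ˡ_; _↑ʳ_; join; splitAt) renaming (zero to fzero; suc to fsuc)
open import Data.Fin.Properties
  using (any?; all?; ↑ˡ-injective; ↑ʳ-injective; splitAt-↑ˡ; splitAt-↑ʳ; join-splitAt)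
open import Data.List using (List; []; _∷_; length; take; allFin)
open import Data.List.Properties using (length-take; filter-≐)
open import Data.List.Membership.Propositional using (_∈_)
open import Data.List.Membership.Propositional.Properties using (∈-length; ∈-filter⁺; ∈-allFin)
open import Data.List.Relation.Unary.All using (All; []; _∷_)
open import Data.List.Relation.Unary.All.Properties using (all-filter)
open import Data.List.Relation.Unary.Any using (here; there)
open import Data.List.Relation.Unary.Unique.Propositional using (Unique; []; _∷_)
open import Data.List.Relation.Unary.Unique.Propositional.Properties using (allFin⁺; filter⁺)
open import Data.Nat using (ℕ; zero; suc; _+_; _≤ᵇ_; _≤_; _<_; _≤′_; ≤′-refl; ≤′-step; z≤n; s≤s)
open import Data.Nat.Properties
  using (≤-refl; ≤-trans; ≤-pred; ≤⇒≤′; ≮⇒≥; m≤n⇒m≤1+n; n≤1+n; m<n⇒m<1+n; ≤ᵇ⇒≤; ≤⇒≤ᵇ; m⊓n≤m)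
open import Data.Product using (_×_; _,_; proj₂; ∃-syntax)
open import Data.Sum using (_⊎_; inj₁; inj₂)
open import Function using (_∘_; id)
open import Function.Bundles using (Equivalence)
open import Level using (0ℓ)
open import Relation.Nullary using (¬_; Dec; yes; no; contradiction)
open import Relation.Nullary.Decidable using (map′; T?; toWitness; fromWitness)
open import Relation.Unary using (Pred; Decidable)
open import Relation.Binary.PropositionalEquality
  using (_≡_; _≢_; _≗_; refl; sym; trans; cong; cong₂; subst)

open Equivalence using (to; from)

2≤length : ∀ {A : Set} {x y : A} {xs : List A} → x ∈ xs → y ∈ xs → x ≢ y → 2 ≤ length xs
2≤length (here refl) (here refl) x≢y = contradiction refl x≢y
2≤length (here _)    (there y∈)  _   = s≤s (∈-length y∈)
2≤length (there x∈)  (here _)    _   = s≤s (∈-length x∈)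
2≤length (there x∈)  (there y∈)  x≢y = m≤n⇒m≤1+n (2≤length x∈ y∈ x≢y)

unique-length≤1 : ∀ {A : Set} {P : Pred A 0ℓ} {xs : List A} →
                  (∀ {u w} → P u → P w → u ≡ w) → Unique xs → All P xs → length xs ≤ 1
unique-length≤1 _ _ [] = z≤n
unique-length≤1 _ _ (_ ∷ []) = ≤-refl
unique-length≤1 P-unique ((x≢y ∷ _) ∷ _) (px ∷ py ∷ _) = contradiction (P-unique px py) x≢y

∃-length≤? : ∀ {N} {P : Pred (List (Fin N)) 0ℓ} → Decidable P → ∀ k → Dec (∃[ xs ] length xs ≤ k × P xs)
∃-length≤? P? zero =
  map′ (λ p → [] , z≤n , p) (λ { ([] , _ , p) → p ; (_ ∷ _ , () , _) }) (P? [])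
∃-length≤? P? (suc k) with P? []
... | yes p = yes ([] , z≤n , p)
... | no ¬p = map′ (λ (x , xs , |xs|≤k , p) → x ∷ xs , s≤s |xs|≤k , p)
                   (λ { ([] , _ , p) → contradiction p ¬p ; (x ∷ xs , s≤s |xs|≤k , p) → x , xs , |xs|≤k , p })
                   (any? λ x → ∃-length≤? (P? ∘ (x ∷_)) k)

AtMostOne : ∀ {N} → (Fin N → Bool) → Set
AtMostOne B = ∀ {u w} → T (B u) → T (B w) → u ≡ w

isSource-unique : ∀ {N} (s : List (Fin N)) j {u w} → T (isSource s j u) → T (isSource s j w) → u ≡ w
isSource-unique []      _       ()
isSource-unique (x ∷ _) zero    p q = trans (sym (toWitness p)) (toWitness q)
isSource-unique (_ ∷ s) (suc j) p q = isSource-unique s j p q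

isSource-take : ∀ {N} (s : List (Fin N)) {r j} → j < r → isSource (take r s) j ≗ isSource s j
isSource-take []      {suc r} _ _ = refl
isSource-take (_ ∷ _) {suc r} {zero}  _         _ = refl
isSource-take (_ ∷ s) {suc r} {suc j} (s≤s j<r) v = isSource-take s j<r v

module _ {N} (G : Graph N) where

  blueNbrs≤1 : ∀ {B} → AtMostOne B → ∀ v → blueNbrs G B v ≤ 1
  blueNbrs≤1 {B} B-unique v =
    unique-length≤1 (λ p q → B-unique (proj₂ (to T-∧ p)) (proj₂ (to T-∧ q)))
                    (filter⁺ (T? ∘ nbr) (allFin⁺ N)) (all-filter (T? ∘ nbr) (allFin N))
    where nbr = λ u → adj G v u ∧ B u

  2≤blueNbrs : ∀ {B v u w} → u ≢ w → T (adj G v u ∧ B u) → T (adj G v w ∧ B w) → 2 ≤ blueNbrs G B v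
  2≤blueNbrs {B} {v} {u} {w} u≢w pu pw =
    2≤length (∈-filter⁺ (T? ∘ nbr) (∈-allFin u) pu) (∈-filter⁺ (T? ∘ nbr) (∈-allFin w) pw) u≢w
    where nbr = λ u → adj G v u ∧ B u

  blueNbrs-cong : ∀ {B B'} → B ≗ B' → ∀ v → blueNbrs G B v ≡ blueNbrs G B' v
  blueNbrs-cong {B} {B'} B≗B' v =
    cong length (filter-≐ (T? ∘ nbr B) (T? ∘ nbr B') (transport B≗B' , transport (sym ∘ B≗B')) (allFin N))
    where
    nbr : (Fin N → Bool) → Fin N → Bool
    nbr C u = adj G v u ∧ C u
    transport : ∀ {C C'} → C ≗ C' → ∀ {u} → T (nbr C u) → T (nbr C' u)
    transport C≗C' {u} = subst T (cong (adj G v u ∧_) (C≗C' u))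

  blue-suc : ∀ s r v → T (blue G s r v) → T (blue G s (suc r) v)
  blue-suc s r v = from T-∨ ∘ inj₁

  source-blue : ∀ s r v → T (isSource s r v) → T (blue G s (suc r) v)
  source-blue s r v = from (T-∨ {blue G s r v}) ∘ inj₂ ∘ from T-∨ ∘ inj₁

  blue-spread : ∀ s r {v u w} → u ≢ w → T (adj G v u) → T (adj G v w) →
                T (blue G s r u) → T (blue G s r w) → T (blue G s (suc r) v)
  blue-spread s r {v} u≢w vu vw bu bw =
    from (T-∨ {blue G s r v}) (inj₂ (from (T-∨ {isSource s r v}) (inj₂ (≤⇒≤ᵇ two-blue-nbrs))))
    where two-blue-nbrs = 2≤blueNbrs u≢w (from T-∧ (vu , bu)) (from T-∧ (vw , bw))

  blue-suc⊆ : ∀ s r v → AtMostOne (blue G s r) →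
              T (blue G s (suc r) v) → T (blue G s r v) ⊎ T (isSource s r v)
  blue-suc⊆ s r v unique b with to T-∨ b
  ... | inj₁ p = inj₁ p
  ... | inj₂ q with to T-∨ q
  ...   | inj₁ p = inj₂ p
  ...   | inj₂ p = contradiction (≤-trans (≤ᵇ⇒≤ 2 _ p) (blueNbrs≤1 unique v)) λ { (s≤s ()) }

  blue-mono : ∀ s {r r'} v → r ≤′ r' → T (blue G s r v) → T (blue G s r' v)
  blue-mono s v ≤′-refl = id
  blue-mono s {r' = suc r'} v (≤′-step r≤r') = blue-suc s r' v ∘ blue-mono s v r≤r'

  allBlueAt-mono : ∀ s {r r'} → r ≤ r' → AllBlueAt G s r → AllBlueAt G s r'
  allBlueAt-mono s r≤r' done v = blue-mono s v (≤⇒≤′ r≤r') (done v)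

  blue-cong : ∀ {s t} r → (∀ {j} → j < r → isSource s j ≗ isSource t j) → blue G s r ≗ blue G t r
  blue-cong zero _ _ = refl
  blue-cong {s} {t} (suc r) s≗t v =
    cong₂ _∨_ (blue-cong r s≗t′ v)
              (cong₂ _∨_ (s≗t ≤-refl v) (cong (2 ≤ᵇ_) (blueNbrs-cong (blue-cong r s≗t′) v)))
    where
    s≗t′ : ∀ {j} → j < r → isSource s j ≗ isSource t j
    s≗t′ j<r = s≗t (m<n⇒m<1+n j<r)

  allBlueAt-take : ∀ s r → AllBlueAt G s r → AllBlueAt G (take r s) r
  allBlueAt-take s r done v = subst T (sym (blue-cong r (isSource-take s) v)) (done v)

  short-allBlueAt? : ∀ r → Dec (∃[ s ] length s ≤ r × AllBlueAt G s r)
  short-allBlueAt? r = ∃-length≤? (λ s → all? λ v → T? (blue G s r v)) r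

  allBlueAt⇒short : ∀ {s} r → AllBlueAt G s r → ∃[ s' ] length s' ≤ r × AllBlueAt G s' r
  allBlueAt⇒short {s} r done =
    take r s , subst (_≤ r) (sym (length-take r s)) (m⊓n≤m r (length s)) , allBlueAt-take s r done

  blue₁ : ∀ s v → T (blue G s 1 v) → T (isSource s 0 v)
  blue₁ s v b with blue-suc⊆ s 0 v (λ ()) b
  ... | inj₂ p = p

  blue₂ : ∀ s v → T (blue G s 2 v) → T (isSource s 0 v) ⊎ T (isSource s 1 v)
  blue₂ s v b with blue-suc⊆ s 1 v (λ p q → isSource-unique s 0 (blue₁ s _ p) (blue₁ s _ q)) b
  ... | inj₁ p = inj₁ (blue₁ s v p)
  ... | inj₂ p = inj₂ p

  NotAllBlueAt : ℕ → Set
  NotAllBlueAt r = ∀ s → ¬ AllBlueAt G s r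

  notAllBlueAt-2 : ∀ {x y z} → x ≢ y → x ≢ z → y ≢ z → NotAllBlueAt 2
  notAllBlueAt-2 {x} {y} {z} x≢y x≢z y≢z s done =
    pigeonhole (blue₂ s x (done x)) (blue₂ s y (done y)) (blue₂ s z (done z))
    where
    pigeonhole : T (isSource s 0 x) ⊎ T (isSource s 1 x) → T (isSource s 0 y) ⊎ T (isSource s 1 y) →
                 T (isSource s 0 z) ⊎ T (isSource s 1 z) → ⊥
    pigeonhole (inj₁ p) (inj₁ q) _        = x≢y (isSource-unique s 0 p q)
    pigeonhole (inj₂ p) (inj₂ q) _        = x≢y (isSource-unique s 1 p q)
    pigeonhole (inj₁ p) _        (inj₁ q) = x≢z (isSource-unique s 0 p q)
    pigeonhole (inj₂ p) _        (inj₂ q) = x≢z (isSource-unique s 1 p q)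
    pigeonhole _        (inj₁ p) (inj₁ q) = y≢z (isSource-unique s 0 p q)
    pigeonhole _        (inj₂ p) (inj₂ q) = y≢z (isSource-unique s 1 p q)

  rd-suc : ∀ {s} r → NotAllBlueAt r → AllBlueAt G s (suc r) → Rd G s (suc r)
  rd-suc {s} r none done = done , λ r' r'<1+r done' → none s (allBlueAt-mono s (≤-pred r'<1+r) done')

  optimal-suc : ∀ {s} r → NotAllBlueAt r → AllBlueAt G s (suc r) → Optimal G s
  optimal-suc r none done =
    suc r , rd-suc r none done ,
    λ s' r' (done' , _) → ≮⇒≥ λ r'<1+r → none s' (allBlueAt-mono s' (≤-pred r'<1+r) done')

  b₂≤2+r-t₂≤1+r : ∀ s {r} → NotAllBlueAt r → AllBlueAt G s (2 + r) → length s ≤ 1 + r →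
                  B2≤ G (2 + r) × T2≤ G (1 + r)
  b₂≤2+r-t₂≤1+r s {r} none done |s|≤1+r with short-allBlueAt? (1 + r)
  ... | yes (s' , |s'|≤1+r , done') =
    (s' , 1 + r , rd-suc r none done' , n≤1+n _) , (s' , optimal-suc r none done' , |s'|≤1+r)
  ... | no ¬short =
    (s , 2 + r , rd-suc (1 + r) none′ done , ≤-refl) , (s , optimal-suc (1 + r) none′ done , |s|≤1+r)
    where
    none′ : NotAllBlueAt (1 + r)
    none′ _ done' = ¬short (allBlueAt⇒short (1 + r) done')

module _ {m n} (G : Graph m) (H : Graph n) where

  ∨ᴳ-adj-ˡʳ : ∀ a b → T (adj (G ∨ᴳ H) (a ↑ˡ n) (m ↑ʳ b))
  ∨ᴳ-adj-ˡʳ a b rewrite splitAt-↑ˡ m a n | splitAt-↑ʳ m n b = _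

  ∨ᴳ-adj-ʳˡ : ∀ a b → T (adj (G ∨ᴳ H) (m ↑ʳ b) (a ↑ˡ n))
  ∨ᴳ-adj-ʳˡ a b rewrite splitAt-↑ˡ m a n | splitAt-↑ʳ m n b = _

  ∨ᴳ-allBlueAt-4 : ∀ {g g' h h'} → g ≢ g' → h ≢ h' → AllBlueAt (G ∨ᴳ H) ((g ↑ˡ n) ∷ (g' ↑ˡ n) ∷ []) 4
  ∨ᴳ-allBlueAt-4 {g} {g'} {h} {h'} g≢g' h≢h' v =
    subst (T ∘ blue J s 4) (join-splitAt m n v) (blue₄ (splitAt m v))
    where
    J = G ∨ᴳ H
    s = (g ↑ˡ n) ∷ (g' ↑ˡ n) ∷ []
    g-blue₂ : T (blue J s 2 (g ↑ˡ n))
    g-blue₂ = blue-suc J s 1 _ (source-blue J s 0 _ (fromWitness refl))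
    g'-blue₂ : T (blue J s 2 (g' ↑ˡ n))
    g'-blue₂ = source-blue J s 1 _ (fromWitness refl)
    H-blue₃ : ∀ b → T (blue J s 3 (m ↑ʳ b))
    H-blue₃ b =
      blue-spread J s 2 (g≢g' ∘ ↑ˡ-injective n g g') (∨ᴳ-adj-ʳˡ g b) (∨ᴳ-adj-ʳˡ g' b) g-blue₂ g'-blue₂
    blue₄ : ∀ x → T (blue J s 4 (join m n x))
    blue₄ (inj₁ a) =
      blue-spread J s 3 (h≢h' ∘ ↑ʳ-injective m h h') (∨ᴳ-adj-ˡʳ a h) (∨ᴳ-adj-ˡʳ a h') (H-blue₃ h) (H-blue₃ h')
    blue₄ (inj₂ b) = blue-suc J s 3 _ (H-blue₃ b)

mainTheorem17 : (m n : ℕ) → 2 ≤ m → 2 ≤ n → (G : Graph m) → (H : Graph n) →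
    B2≤ (G ∨ᴳ H) 4 × T2≤ (G ∨ᴳ H) 3
mainTheorem17 (suc (suc m)) (suc (suc n)) (s≤s (s≤s _)) (s≤s (s≤s _)) G H =
  b₂≤2+r-t₂≤1+r (G ∨ᴳ H) (fzero ∷ fsuc fzero ∷ [])
    (notAllBlueAt-2 (G ∨ᴳ H) {fzero} {fsuc fzero} {fsuc (fsuc (m ↑ʳ fzero))} (λ ()) (λ ()) (λ ()))
    (∨ᴳ-allBlueAt-4 G H {fzero} {fsuc fzero} {fzero} {fsuc fzero} (λ ()) (λ ()))
    (s≤s (s≤s z≤n))
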